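{- Let $\lambda,\mu$ be strict partitions with $\mu\subseteq\lambda$, and let $\mathcal{C},\mathcal{C}'$ be configurations for $\lambda/\mu$ such that $\mathcal{C}'$ is obtained from $\mathcal{C}$ by exchanging the $0$'s of two rows $a$ and $b$, where in $\mathcal{C}$ row $a$ has type $(e,e)$ and row $b$ has type $(\emptyset,o)$, and in $\mathcal{C}'$ row $a$ has type $(\emptyset,e)$ and row $b$ has type $(e,o)$. Then $\kappa(\mathcal{C}')\le\kappa(\mathcal{C})$.
   Context: Let $S(\lambda)$ be the shifted diagram of $\lambda$ (row $i$ of the Young diagram shifted $i-1$ squares right). A configuration $\mathcal{C}$ of $0$'s for $\lambda/\mu$ assigns to each row $i$ an integer $z_i$ with $0\le z_i\le\lambda_i$ (the leftmost $z_i$ squares of row $i$ are filled with $0$, the other $\lambda_i-z_i$ squares are blank), such that the nonzero $z_i$'s, arranged in decreasing order, are exactly the parts of $\mu$. Exchanging the $0$'s of rows $a\ne b$ means replacing $(z_a,z_b)$ by $(z_b,z_a)$ (when this is again a configuration). Row types: $(e,e)$: $z_i>0$ even and $\lambda_i-z_i>0$ even; $(e,o)$: $z_i>0$ even, $\lambda_i-z_i$ odd; $(o,e)$: $z_i$ odd, $\lambda_i-z_i>0$ even; $(o,o)$: $z_i$ odd, $\lambda_i-z_i$ odd; $(\emptyset,e)$: $z_i=0$, $\lambda_i$ even; $(\emptyset,o)$: $z_i=0$, $\lambda_i$ odd; $(e,\emptyset)$: $z_i=\lambda_i$ even; $(o,\emptyset)$: $z_i=\lambda_i$ odd. Let $o_r$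 (resp. $e_r$) be the number of rows with $z_i=0$ and $\lambda_i$ odd (resp. even), and $o_s$ (resp. $e_s$) the number of rows with $z_i>0$ and $\lambda_i-z_i$ odd (resp. even and nonzero). Define $\kappa(\mathcal{C})=o_s+2e_s+\max\big(o_r,\ e_r+((e_r+o_r)\bmod 2)\big)$. -}

module Defs where

open import Data.Nat using (ℕ; zero; suc; _+_; _*_; _∸_; _≤_; _<_; _⊔_; _%_)
open import Data.Bool using (Bool; true; false; if_then_else_; _∧_; not)
open import Data.List using (List; []; _∷_; filter; length)
open import Data.List.Relation.Unary.All using (All)
open import Data.List.Relation.Unary.Linked using (Linked)
open import Data.List.Relation.Binary.Permutation.Propositional using (_↭_)
open import Data.Vec using (Vec; toList; lookup; _[_]≔_; zipWith)
open import Data.Fin using (Fin)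
open import Data.Product using (_×_)
open import Relation.Binary.PropositionalEquality using (_≡_)
import Data.Nat.Properties as ℕP

Even : ℕ → Set
Even n = n % 2 ≡ 0

Odd : ℕ → Set
Odd n = n % 2 ≡ 1

isEven : ℕ → Bool
isEven zero = true
isEven (suc n) = not (isEven n)

isZero : ℕ → Bool
isZero zero = true
isZero (suc _) = false

StrictPartition : List ℕ → Set
StrictPartition p = All (0 <_) p × Linked (λ x y → y < x) p

data _⊆ₚ_ : List ℕ → List ℕ → Set where
  []⊆  : ∀ {l} → [] ⊆ₚ l
  ∷⊆   : ∀ {m l ms ls} → m ≤ l → ms ⊆ₚ ls → (m ∷ ms) ⊆ₚ (l ∷ ls)

-- A configuration of 0's for λ/μ, λ given as a vector of its n rows:
-- z i is the number of 0's in row i; 0 ≤ zᵢ ≤ λᵢ, and the nonzero zᵢ,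
-- arranged in decreasing order, are the parts of μ (equivalently, since μ
-- is strictly decreasing, the list of nonzero zᵢ is a permutation of μ).
IsConfiguration : ∀ {n} → Vec ℕ n → List ℕ → Vec ℕ n → Set
IsConfiguration {n} lam mu z =
  ((i : Fin n) → lookup z i ≤ lookup lam i) ×
  (filter (λ x → 0 <? x) (toList z) ↭ mu)
  where open import Data.Nat using (_<?_)

exchange : ∀ {n} → Vec ℕ n → Fin n → Fin n → Vec ℕ n
exchange z a b = (z [ a ]≔ lookup z b) [ b ]≔ lookup z a

TypeEE : ℕ → ℕ → Set
TypeEE z l = 0 < z × Even z × 0 < l ∸ z × Even (l ∸ z)

TypeEmptyO : ℕ → ℕ → Set
TypeEmptyO z l = z ≡ 0 × Odd l

TypeEmptyE : ℕ → ℕ → Set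
TypeEmptyE z l = z ≡ 0 × Even l

TypeEO : ℕ → ℕ → Set
TypeEO z l = 0 < z × Even z × Odd (l ∸ z)

count : (ℕ → ℕ → Bool) → List ℕ → List ℕ → ℕ
count p (l ∷ ls) (z ∷ zs) = (if p l z then 1 else 0) + count p ls zs
count p _ _ = 0

isOr isEr isOs isEs : ℕ → ℕ → Bool
isOr l z = isZero z ∧ not (isEven l)
isEr l z = isZero z ∧ isEven l
isOs l z = not (isZero z) ∧ not (isEven (l ∸ z))
isEs l z = not (isZero z) ∧ (isEven (l ∸ z) ∧ not (isZero (l ∸ z)))

κ : ∀ {n} → Vec ℕ n → Vec ℕ n → ℕ
κ lam z =
  let L = toList lam ; Z = toList z
      o-r = count isOr L Z ; e-r = count isEr L Z
      o-s = count isOs L Z ; e-s = count isEs L Z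
  in o-s + 2 * e-s + (o-r ⊔ (e-r + ((e-r + o-r) % 2)))

-- Exchanging the 0's moves row a from e_s to e_r and row b from o_r to o_s,
-- and leaves every other row alone. So o_s + 2 e_s drops by 1, the parity of
-- e_r + o_r is unchanged, and the maximum term rises by at most 1.
module Submission where

open import Defs
open import Data.Nat using (ℕ; _≤_)
open import Data.List using (List)
open import Data.Vec using (Vec; toList; lookup)
open import Data.Fin using (Fin)
open import Relation.Binary.PropositionalEquality using (_≢_)

open import Data.Bool using (Bool; true; false; if_then_else_)
open import Data.Bool.Properties using (not-involutive)
open import Data.Fin using (zero; suc)
open import Data.Nat using (zero; suc; _+_; _*_; _∸_; _<_; _⊔_; _%_; s≤s)
open import Data.Nat.Properties
open import Algebra.Properties.CommutativeSemigroup +-commutativeSemigroup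
  using (x∙yz≈y∙xz)
open import Data.Nat.Solver using (module +-*-Solver)
open import Data.Product using (_,_)
open import Data.Vec using (_∷_; _[_]≔_)
open import Data.Vec.Properties using (lookup∘update; lookup∘update′)
open import Relation.Binary.PropositionalEquality
  using (_≡_; refl; sym; cong; subst; module ≡-Reasoning)

isEven-Even : ∀ n → Even n → isEven n ≡ true
isEven-Even zero          _ = refl
isEven-Even (suc (suc n)) e rewrite not-involutive (isEven n) = isEven-Even n e

isEven-Odd : ∀ n → Odd n → isEven n ≡ false
isEven-Odd (suc zero)    _ = refl
isEven-Odd (suc (suc n)) o rewrite not-involutive (isEven n) = isEven-Odd n o

isZero-pos : ∀ {n} → 0 < n → isZero n ≡ false
isZero-pos (s≤s _) = refl

data Statistic : Set where
  oᵣ eᵣ oₛ eₛ : Statistic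

_==_ : Statistic → Statistic → Bool
oᵣ == oᵣ = true
eᵣ == eᵣ = true
oₛ == oₛ = true
eₛ == eₛ = true
_  == _  = false

isCounted : Statistic → ℕ → ℕ → Bool
isCounted oᵣ = isOr
isCounted eᵣ = isEr
isCounted oₛ = isOs
isCounted eₛ = isEs

TypeEE⇒isCounted : ∀ {z} l → TypeEE z l → ∀ s → isCounted s l z ≡ (s == eₛ)
TypeEE⇒isCounted l (s≤s _ , _ , _ , _) oᵣ = refl
TypeEE⇒isCounted l (s≤s _ , _ , _ , _) eᵣ = refl
TypeEE⇒isCounted {suc z} l (s≤s _ , _ , _ , d-even) oₛ
  rewrite isEven-Even (l ∸ suc z) d-even = refl
TypeEE⇒isCounted {suc z} l (s≤s _ , _ , d>0 , d-even) eₛ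
  rewrite isEven-Even (l ∸ suc z) d-even | isZero-pos d>0 = refl

TypeEmptyO⇒isCounted : ∀ {z} l → TypeEmptyO z l → ∀ s → isCounted s l z ≡ (s == oᵣ)
TypeEmptyO⇒isCounted l (refl , l-odd) oᵣ rewrite isEven-Odd l l-odd = refl
TypeEmptyO⇒isCounted l (refl , l-odd) eᵣ rewrite isEven-Odd l l-odd = refl
TypeEmptyO⇒isCounted l (refl , _)     oₛ = refl
TypeEmptyO⇒isCounted l (refl , _)     eₛ = refl

TypeEmptyE⇒isCounted : ∀ {z} l → TypeEmptyE z l → ∀ s → isCounted s l z ≡ (s == eᵣ)
TypeEmptyE⇒isCounted l (refl , l-even) oᵣ rewrite isEven-Even l l-even = refl
TypeEmptyE⇒isCounted l (refl , l-even) eᵣ rewrite isEven-Even l l-even = refl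
TypeEmptyE⇒isCounted l (refl , _)      oₛ = refl
TypeEmptyE⇒isCounted l (refl , _)      eₛ = refl

TypeEO⇒isCounted : ∀ {z} l → TypeEO z l → ∀ s → isCounted s l z ≡ (s == oₛ)
TypeEO⇒isCounted l (s≤s _ , _ , _) oᵣ = refl
TypeEO⇒isCounted l (s≤s _ , _ , _) eᵣ = refl
TypeEO⇒isCounted {suc z} l (s≤s _ , _ , d-odd) oₛ
  rewrite isEven-Odd (l ∸ suc z) d-odd = refl
TypeEO⇒isCounted {suc z} l (s≤s _ , _ , d-odd) eₛ
  rewrite isEven-Odd (l ∸ suc z) d-odd = refl

-- Definitionally the summand of `count` (unlike `Data.Bool.toℕ`).
𝟙 : Bool → ℕ
𝟙 b = if b then 1 else 0

count-update : ∀ {n} p (lam z : Vec ℕ n) i v →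
  𝟙 (p (lookup lam i) (lookup z i)) + count p (toList lam) (toList (z [ i ]≔ v))
  ≡ 𝟙 (p (lookup lam i) v) + count p (toList lam) (toList z)
count-update p (l ∷ lam) (x ∷ z) zero    v = x∙yz≈y∙xz (𝟙 (p l x)) (𝟙 (p l v)) _
count-update p (l ∷ lam) (x ∷ z) (suc i) v = begin
  𝟙 (p li zi) + (𝟙 (p l x) + count p (toList lam) (toList (z [ i ]≔ v)))
    ≡⟨ x∙yz≈y∙xz (𝟙 (p li zi)) (𝟙 (p l x)) _ ⟩
  𝟙 (p l x) + (𝟙 (p li zi) + count p (toList lam) (toList (z [ i ]≔ v)))
    ≡⟨ cong (𝟙 (p l x) +_) (count-update p lam z i v) ⟩
  𝟙 (p l x) + (𝟙 (p li v) + count p (toList lam) (toList z))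
    ≡⟨ x∙yz≈y∙xz (𝟙 (p l x)) (𝟙 (p li v)) _ ⟩
  𝟙 (p li v) + (𝟙 (p l x) + count p (toList lam) (toList z))
    ∎
  where
  open ≡-Reasoning
  li = lookup lam i
  zi = lookup z i

lookup-exchange-b : ∀ {n} (z : Vec ℕ n) a b → lookup (exchange z a b) b ≡ lookup z a
lookup-exchange-b z a b = lookup∘update b (z [ a ]≔ lookup z b) (lookup z a)

lookup-exchange-a : ∀ {n} (z : Vec ℕ n) {a b} → a ≢ b →
  lookup (exchange z a b) a ≡ lookup z b
lookup-exchange-a z {a} {b} a≢b = begin
  lookup (exchange z a b) a        ≡⟨ lookup∘update′ a≢b (z [ a ]≔ lookup z b) (lookup z a) ⟩
  lookup (z [ a ]≔ lookup z b) a   ≡⟨ lookup∘update a z (lookup z b) ⟩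
  lookup z b                       ∎
  where open ≡-Reasoning

count-exchange : ∀ {n} p (lam z : Vec ℕ n) {a b} → a ≢ b →
  𝟙 (p (lookup lam a) (lookup z a)) + 𝟙 (p (lookup lam b) (lookup z b))
    + count p (toList lam) (toList (exchange z a b))
  ≡ 𝟙 (p (lookup lam a) (lookup z b)) + 𝟙 (p (lookup lam b) (lookup z a))
    + count p (toList lam) (toList z)
count-exchange p lam z {a} {b} a≢b = begin
  A + B + C′                ≡⟨ +-assoc A B C′ ⟩
  A + (B + C′)              ≡⟨ cong (λ w → A + (𝟙 (p lb w) + C′)) (sym zb-unchanged) ⟩
  A + (B₁ + C′)             ≡⟨ cong (A +_) (count-update p lam z₁ b (lookup z a)) ⟩
  A + (B′ + C₁)             ≡⟨ x∙yz≈y∙xz A B′ C₁ ⟩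
  B′ + (A + C₁)             ≡⟨ cong (B′ +_) (count-update p lam z a (lookup z b)) ⟩
  B′ + (A′ + C)             ≡⟨ x∙yz≈y∙xz B′ A′ C ⟩
  A′ + (B′ + C)             ≡⟨ sym (+-assoc A′ B′ C) ⟩
  A′ + B′ + C               ∎
  where
  open ≡-Reasoning
  la = lookup lam a
  lb = lookup lam b
  z₁ = z [ a ]≔ lookup z b
  zb-unchanged : lookup z₁ b ≡ lookup z b
  zb-unchanged = lookup∘update′ (λ b≡a → a≢b (sym b≡a)) z (lookup z b)
  A = 𝟙 (p la (lookup z a))
  B = 𝟙 (p lb (lookup z b))
  A′ = 𝟙 (p la (lookup z b))
  B′ = 𝟙 (p lb (lookup z a))
  B₁ = 𝟙 (p lb (lookup z₁ b))
  C = count p (toList lam) (toList z)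
  C₁ = count p (toList lam) (toList z₁)
  C′ = count p (toList lam) (toList (exchange z a b))

κ-formula : (os es or er : ℕ) → ℕ
κ-formula os es or er = os + 2 * es + (or ⊔ (er + (er + or) % 2))

m⊔1+n≤2+m⊔n : ∀ m n → m ⊔ suc n ≤ suc (suc m ⊔ n)
m⊔1+n≤2+m⊔n m n = ⊔-lub (≤-trans (n≤1+n m) (≤-trans (m≤m⊔n (suc m) n) (n≤1+n _)))
                        (s≤s (m≤n⊔m (suc m) n))

κ-formula-exchange : ∀ {os os′ es es′ or or′ er er′} →
  os′ ≡ suc os → suc es′ ≡ es → suc or′ ≡ or → er′ ≡ suc er →
  κ-formula os′ es′ or′ er′ ≤ κ-formula os es or er
κ-formula-exchange {os} {es′ = es′} {or′ = or′} {er} refl refl refl refl = begin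
  suc os + 2 * es′ + (or′ ⊔ (suc er + (suc er + or′) % 2))
    ≡⟨ cong (λ k → suc os + 2 * es′ + (or′ ⊔ suc (er + k % 2))) (sym (+-suc er or′)) ⟩
  suc os + 2 * es′ + (or′ ⊔ suc (er + p))
    ≤⟨ +-monoʳ-≤ (suc os + 2 * es′) (m⊔1+n≤2+m⊔n or′ (er + p)) ⟩
  suc os + 2 * es′ + suc (suc or′ ⊔ (er + p))
    ≡⟨ regroup os es′ (suc or′ ⊔ (er + p)) ⟩
  os + 2 * suc es′ + (suc or′ ⊔ (er + p))
    ∎
  where
  open ≤-Reasoning
  p = (er + suc or′) % 2
  regroup : ∀ a b k → suc a + 2 * b + suc k ≡ a + 2 * suc b + k
  regroup = solve 3 (λ a b k → (con 1 :+ a) :+ con 2 :* b :+ (con 1 :+ k)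
                             := a :+ con 2 :* (con 1 :+ b) :+ k) refl
    where open +-*-Solver

mainTheorem6 : ∀ {n} (lam : Vec ℕ n) (mu : List ℕ) (z : Vec ℕ n) (a b : Fin n) →
    StrictPartition (toList lam) → StrictPartition mu → mu ⊆ₚ toList lam →
    a ≢ b →
    IsConfiguration lam mu z →
    IsConfiguration lam mu (exchange z a b) →
    TypeEE (lookup z a) (lookup lam a) →
    TypeEmptyO (lookup z b) (lookup lam b) →
    TypeEmptyE (lookup (exchange z a b) a) (lookup lam a) →
    TypeEO (lookup (exchange z a b) b) (lookup lam b) →
    κ lam (exchange z a b) ≤ κ lam z
mainTheorem6 lam _ z a b _ _ _ a≢b _ _ a-ee b-∅o a-∅e b-eo =
  κ-formula-exchange (count-shift oₛ) (count-shift eₛ) (count-shift oᵣ) (count-shift eᵣ)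
  where
  la = lookup lam a
  lb = lookup lam b
  a-∅e′ : TypeEmptyE (lookup z b) la
  a-∅e′ = subst (λ w → TypeEmptyE w la) (lookup-exchange-a z a≢b) a-∅e
  b-eo′ : TypeEO (lookup z a) lb
  b-eo′ = subst (λ w → TypeEO w lb) (lookup-exchange-b z a b) b-eo
  count-shift : ∀ s →
    𝟙 (s == eₛ) + 𝟙 (s == oᵣ) + count (isCounted s) (toList lam) (toList (exchange z a b))
    ≡ 𝟙 (s == eᵣ) + 𝟙 (s == oₛ) + count (isCounted s) (toList lam) (toList z)
  count-shift s
    rewrite sym (TypeEE⇒isCounted la a-ee s) | sym (TypeEmptyO⇒isCounted lb b-∅o s)
          | sym (TypeEmptyE⇒isCounted la a-∅e′ s) | sym (TypeEO⇒isCounted lb b-eo′ s)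
    = count-exchange (isCounted s) lam z a≢b
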